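{- Let $n$ be an even positive integer, $p$ a prime, and $p^a$ the largest power of $p$ dividing $n$. Suppose there is a prime $q$ with $q<n/2$ and $n-2q<p^a$. If some multiple $k$ of $p^a$ lies in the interval $[q,n/2]$, then $p$ is odd and $k=n/2$. -}

module Defs where

module Submission where

-- Write P = p ^ a.  Both 2k and n are multiples of P
-- (n by hypothesis, 2k because P ∣ k), and they lie close together:
--   2k ≤ n  and  n ≤ (n ∸ 2q) + 2q < P + 2q ≤ P + 2k.
-- Two multiples of a positive number d whose distance is less than d
-- coincide, so 2k = n.  If p were even it would equal 2, and then
-- p ^ (a + 1) = 2P would divide 2k = n, contradicting the maximality of a.

open import Defs
open import Data.Nat using (ℕ; suc; _+_; _*_; _∸_; _^_; _≤_; _<_; NonZero)
open import Data.Nat.Divisibility using (_∣_; divides; *-monoʳ-∣; ∣n⇒∣m*n)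
open import Data.Nat.Primality using (Prime; prime⇒irreducible; prime⇒nonZero)
open import Data.Nat.Properties
open import Data.Product using (_×_; _,_)
open import Data.Sum using (inj₁; inj₂)
open import Relation.Nullary using (¬_)
open import Relation.Binary.PropositionalEquality

-- Two multiples of a nonzero d with x ≤ y < d + x are equal: writing
-- x = i·d and y = j·d, the inequalities force i ≤ j < i + 1.
multiples-within-distance-equal : ∀ d {x y} .{{_ : NonZero d}}
  → d ∣ x → d ∣ y → x ≤ y → y < d + x → x ≡ y
multiples-within-distance-equal d (divides i refl) (divides j refl) x≤y y<d+x =
  cong (_* d) (≤-antisym i≤j (≤-pred j<1+i))
  where
  i≤j : i ≤ j
  i≤j = *-cancelʳ-≤ i j d x≤y
  j<1+i : j < suc i
  j<1+i = *-cancelʳ-< d j (suc i) y<d+x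

bound-from-truncated-difference : ∀ {n c d b} → n ∸ c < b → c ≤ d → n < b + d
bound-from-truncated-difference {n} {c} {d} {b} n∸c<b c≤d = begin-strict
  n             ≤⟨ m≤n+m∸n n c ⟩
  c + (n ∸ c)   ≡⟨ +-comm c (n ∸ c) ⟩
  (n ∸ c) + c   <⟨ +-monoˡ-< c n∸c<b ⟩
  b + c         ≤⟨ +-monoʳ-≤ b c≤d ⟩
  b + d         ∎
  where open ≤-Reasoning

even-prime≡2 : ∀ {p} → Prime p → 2 ∣ p → p ≡ 2
even-prime≡2 pp 2∣p with prime⇒irreducible pp 2∣p
... | inj₁ ()
... | inj₂ 2≡p = sym 2≡p

lemma3p4 : (n p a q k : ℕ) → 0 < n → 2 ∣ n → Prime p
    → p ^ a ∣ n → ¬ (p ^ suc a ∣ n)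
    → Prime q → 2 * q < n → n ∸ 2 * q < p ^ a
    → p ^ a ∣ k → q ≤ k → 2 * k ≤ n
    → ¬ (2 ∣ p) × 2 * k ≡ n
lemma3p4 n p a q k _ _ pp P∣n pP∤n _ _ n∸2q<P P∣k q≤k 2k≤n = p-odd , 2k≡n
  where
  instance
    p≢0 : NonZero p
    p≢0 = prime⇒nonZero pp
    P≢0 : NonZero (p ^ a)
    P≢0 = m^n≢0 p a

  n<P+2k : n < p ^ a + 2 * k
  n<P+2k = bound-from-truncated-difference n∸2q<P (*-monoʳ-≤ 2 q≤k)

  2k≡n : 2 * k ≡ n
  2k≡n = multiples-within-distance-equal (p ^ a) (∣n⇒∣m*n 2 P∣k) P∣n 2k≤n n<P+2k

  -- If p = 2 then p ^ (a + 1) = 2 · p ^ a divides 2k = n.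
  p-odd : ¬ (2 ∣ p)
  p-odd 2∣p with even-prime≡2 pp 2∣p
  ... | refl = pP∤n (subst (2 * p ^ a ∣_) 2k≡n (*-monoʳ-∣ 2 P∣k))
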